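{- If $q$ is a prime power, then: (i) $\beta(K(q^3,q))\leq q^2(q+2)$; (ii) $\beta(K((q+1)(q^3+1),q+1))\leq (q^2+1)(q^3+1)$; (iii) $\beta(K((q^2+1)(q^5+1),q^2+1))\leq (q^3+1)(q^5+1)$.
   Context: The Kneser graph $K(n,k)$ has as vertices the $k$-subsets of $\{1,\dots,n\}$, adjacent when disjoint. $\beta(G)$ denotes the metric dimension: the minimum size of a set $S$ of vertices such that for every pair of distinct vertices $u,v$ some $x\in S$ has $d(u,x)\neq d(v,x)$. -}

module Defs where

open import Level using (0ℓ)
open import Data.Nat using (ℕ; zero; suc; _+_; _*_; _^_; _≤_; _<_)
open import Data.Nat.Primality using (Prime)
open import Data.Fin using (Fin)
open import Data.Fin.Subset using (Subset; _∈_; ∣_∣)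
open import Data.List using (List; length)
open import Data.List.Membership.Propositional renaming (_∈_ to _∈ₗ_)
open import Data.Product using (Σ; ∃; ∃-syntax; _×_; _,_; proj₁)
open import Data.Sum using (_⊎_)
open import Data.Empty using (⊥)
open import Relation.Nullary using (¬_)
open import Relation.Binary.PropositionalEquality using (_≡_; _≢_)

IsPrimePower : ℕ → Set
IsPrimePower q = ∃[ p ] ∃[ e ] (Prime p × 1 ≤ e × q ≡ p ^ e)

record Graph : Set₁ where
  field
    V   : Set
    Adj : V → V → Set
open Graph public

data Walk (G : Graph) : V G → V G → ℕ → Set where
  here  : ∀ {u} → Walk G u u 0
  there : ∀ {u w v ℓ} → Adj G u w → Walk G w v ℓ → Walk G u v (suc ℓ)

-- Dist G u v d : the graph distance d(u,v) equals d (finite)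
-- (if no such d exists, d(u,v) = ∞)
Dist : (G : Graph) → V G → V G → ℕ → Set
Dist G u v d = Walk G u v d × (∀ m → m < d → ¬ Walk G u v m)

Distinguishes : (G : Graph) → V G → V G → V G → Set
Distinguishes G x u v =
  (∃[ d ] (Dist G u x d × ¬ Dist G v x d)) ⊎ (∃[ d ] (Dist G v x d × ¬ Dist G u x d))

Resolving : (G : Graph) → List (V G) → Set
Resolving G S = ∀ u v → u ≢ v → ∃[ x ] (x ∈ₗ S × Distinguishes G x u v)

MetricDimLE : Graph → ℕ → Set
MetricDimLE G b = ∃[ S ] (Resolving G S × length S ≤ b)

KVertex : ℕ → ℕ → Set
KVertex n k = Σ (Subset n) (λ s → ∣ s ∣ ≡ k)

Disjoint : ∀ {n} → Subset n → Subset n → Set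
Disjoint {n} s t = ∀ (i : Fin n) → i ∈ s → i ∈ t → ⊥

Kneser : ℕ → ℕ → Graph
Kneser n k = record
  { V   = KVertex n k
  ; Adj = λ u v → Disjoint (proj₁ u) (proj₁ v)
  }

module Submission where

-- A set x of k points that contains a point a of u but is disjoint
-- from v is adjacent to v and not to u, so it resolves u and v.  Hence a
-- family S of k-sets resolves K(n,k) as soon as every point a carries a
-- pencil: k+1 members of S containing a which pairwise meet only in a.
-- Indeed, a k-set v avoiding a cannot meet all k+1 members (they would
-- give k+1 distinct points of v), so some member is disjoint from v.
--
-- On the grid Fin k × Fin M ≅ Fin (k * M) take the (k+1) M
-- lines t ↦ b + m t (mod M) of slope m ≤ k.  When k (k - 1) < M, two lines
-- through a common point with different slopes meet nowhere else, because
-- |m - m'| · |t - t'| < M.  This yields β(K(kM, k)) ≤ (k+1) M.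

open import Defs
open import Data.Nat
  using (ℕ; _+_; _*_; _^_; zero; suc; _∸_; _≤_; _<_; z≤n; s≤s; s≤s⁻¹; NonZero; >-nonZero; _%_; _/_)
open import Data.Nat.Properties
  using ( ≡-irrelevant; <⇒≤; ≤-trans; ≤-reflexive; ≤-<-trans; 1+n≰n; <-cmp
        ; +-comm; +-assoc; *-distribˡ-+; *-cancelʳ-≡; *-mono-≤; *-monoˡ-≤
        ; m+[n∸m]≡n; m+n∸n≡m; m∸n≤m; m<n⇒0<n∸m; pred-mono-≤; m≤m+n; m≤m*n; m^n≢0
        ; module ≤-Reasoning )
open import Data.Nat.DivMod
  using (m%n<n; m%n≤n; m≡m%n+[m/n]*n; m%n%n≡m%n; %-distribˡ-+; %-remove-+ʳ; m<n⇒m%n≡m)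
open import Data.Nat.Divisibility using (_∣_; divides)
open import Data.Nat.Primality using (prime⇒nonZero; prime⇒nonTrivial)
open import Data.Nat.Base using (nonTrivial⇒n>1)
open import Data.Nat.Solver using (module +-*-Solver)
open import Data.Fin as Fin using (Fin; combine; remQuot; toℕ; fromℕ<)
open import Data.Fin.Properties
  using (toℕ-injective; toℕ-fromℕ<; toℕ<n; any?; 0≢1+n; suc-injective
        ; combine-surjective; combine-remQuot; remQuot-combine)
open import Data.Fin.Subset using (Subset; _∈_; _∉_; ∣_∣; ⁅_⁆; _-_; inside; outside)
open import Data.Fin.Subset.Properties
  using (_∈?_; x∈⁅x⁆; x∈⁅y⁆⇒x≡y; ∣⁅x⁆∣≡1; x∈p∧x≢y⇒x∈p-y; x∈p⇒∣p-x∣<∣p∣)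
open import Data.Vec using ([]; _∷_; _++_; concat; lookup; here; there)
import Data.Vec as Vec
open import Data.Vec.Properties using (lookup-concat; lookup∘tabulate; []=⇒lookup; lookup⇒[]=)
open import Data.List using (List; length)
import Data.List as List
open import Data.List.Properties using (length-tabulate)
open import Data.List.Membership.Propositional using () renaming (_∈_ to _∈ₗ_)
open import Data.List.Membership.Propositional.Properties using (∈-tabulate⁺)
open import Data.Product using (_×_; ∃-syntax; _,_; proj₁; proj₂; uncurry)
open import Data.Sum using (_⊎_; inj₁; inj₂; [_,_])
open import Function using (_∘_; id)
open import Function.Definitions using (Injective)
open import Relation.Nullary using (¬_; Dec; yes; no; contradiction)
open import Relation.Nullary.Decidable using (_×-dec_; ¬?; decidable-stable)
open import Relation.Binary using (tri<; tri≈; tri>)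
open import Relation.Binary.PropositionalEquality
  using (_≡_; _≢_; refl; sym; trans; cong; cong₂; subst; module ≡-Reasoning)

Differ : ∀ {n} → Subset n → Subset n → Set
Differ p q = ∃[ a ] (a ∈ p × a ∉ q)

differ-∷ : ∀ {n x y} {p q : Subset n} → Differ p q → Differ (x ∷ p) (y ∷ q)
differ-∷ (a , a∈p , a∉q) = Fin.suc a , there a∈p , λ { (there a∈q) → a∉q a∈q }

differ : ∀ {n} (p q : Subset n) → p ≢ q → Differ p q ⊎ Differ q p
differ []            []            p≢q = contradiction refl p≢q
differ (inside ∷ p)  (outside ∷ q) _   = inj₁ (Fin.zero , here , λ ())
differ (outside ∷ p) (inside ∷ q)  _   = inj₂ (Fin.zero , here , λ ())
differ (inside ∷ p)  (inside ∷ q)  p≢q =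
  Data.Sum.map differ-∷ differ-∷ (differ p q (p≢q ∘ cong (inside ∷_)))
differ (outside ∷ p) (outside ∷ q) p≢q =
  Data.Sum.map differ-∷ differ-∷ (differ p q (p≢q ∘ cong (outside ∷_)))

injective⇒≤∣∣ : ∀ {r n} (p : Subset n) (f : Fin r → Fin n) →
  Injective _≡_ _≡_ f → (∀ i → f i ∈ p) → r ≤ ∣ p ∣
injective⇒≤∣∣ {zero}  p f _   _   = z≤n
injective⇒≤∣∣ {suc r} p f inj f∈p = begin
  suc r                  ≤⟨ s≤s (injective⇒≤∣∣ (p - f Fin.zero) (f ∘ Fin.suc) (suc-injective ∘ inj) f∈p-f₀) ⟩
  suc ∣ p - f Fin.zero ∣ ≤⟨ x∈p⇒∣p-x∣<∣p∣ (f∈p Fin.zero) ⟩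
  ∣ p ∣                  ∎
  where
    open ≤-Reasoning
    f∈p-f₀ : ∀ i → f (Fin.suc i) ∈ p - f Fin.zero
    f∈p-f₀ i = x∈p∧x≢y⇒x∈p-y (f∈p (Fin.suc i)) (λ eq → 0≢1+n (sym (inj eq)))

Meet : ∀ {n} → Subset n → Subset n → Set
Meet p q = ∃[ i ] (i ∈ p × i ∈ q)

meet? : ∀ {n} (p q : Subset n) → Dec (Meet p q)
meet? p q = any? (λ i → (i ∈? p) ×-dec (i ∈? q))

module _ {n k : ℕ} where

  private
    G : Graph
    G = Kneser n k

  vertex-≡ : {u v : KVertex n k} → proj₁ u ≡ proj₁ v → u ≡ v
  vertex-≡ {s , p} {.s , p'} refl = cong (s ,_) (≡-irrelevant p p')

  dist-one : ∀ {v x : KVertex n k} {a} → Disjoint (proj₁ v) (proj₁ x) →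
    a ∈ proj₁ x → a ∉ proj₁ v → Dist G v x 1
  dist-one {v} {x} v∩x≡∅ a∈x a∉v = there v∩x≡∅ here , shorter
    where
      shorter : ∀ m → m < 1 → ¬ Walk G v x m
      shorter zero    _         here = a∉v a∈x
      shorter (suc _) (s≤s ()) _

  not-dist-one : ∀ {u x : KVertex n k} {a} → a ∈ proj₁ u → a ∈ proj₁ x → ¬ Dist G u x 1
  not-dist-one a∈u a∈x (there u∩x≡∅ here , _) = u∩x≡∅ _ a∈u a∈x

  record Pencil (S : List (KVertex n k)) (a : Fin n) : Set where
    field
      member     : Fin (suc k) → KVertex n k
      member∈S   : ∀ m → member m ∈ₗ S
      a∈member   : ∀ m → a ∈ proj₁ (member m)
      concurrent : ∀ {m m' i} → i ∈ proj₁ (member m) → i ∈ proj₁ (member m') →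
                   i ≡ a ⊎ m ≡ m'

  -- The members of a pencil at a cannot all meet a k-set v avoiding a:
  -- a common point with each member would give k+1 distinct points of v.
  ¬all-meet : ∀ {S a} (P : Pencil S a) (v : KVertex n k) → a ∉ proj₁ v →
    ¬ (∀ m → Meet (proj₁ (Pencil.member P m)) (proj₁ v))
  ¬all-meet {a = a} P v a∉v meets =
    1+n≰n (≤-trans (injective⇒≤∣∣ (proj₁ v) point point-injective point∈v) (≤-reflexive (proj₂ v)))
    where
      open Pencil P
      point : Fin (suc k) → Fin n
      point m = proj₁ (meets m)
      point∈member : ∀ m → point m ∈ proj₁ (member m)
      point∈member m = proj₁ (proj₂ (meets m))
      point∈v : ∀ m → point m ∈ proj₁ v
      point∈v m = proj₂ (proj₂ (meets m))
      point-injective : Injective _≡_ _≡_ point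
      point-injective {m} {m'} eq =
        [ (λ point≡a → contradiction (subst (_∈ proj₁ v) point≡a (point∈v m)) a∉v) , id ]
          (concurrent (point∈member m) (subst (_∈ proj₁ (member m')) (sym eq) (point∈member m')))

  pencil-misses : ∀ {S a} (P : Pencil S a) (v : KVertex n k) → a ∉ proj₁ v →
    ∃[ m ] Disjoint (proj₁ v) (proj₁ (Pencil.member P m))
  pencil-misses P v a∉v with any? (λ m → ¬? (meet? (proj₁ (Pencil.member P m)) (proj₁ v)))
  ... | yes (m , ¬meet) = m , λ i i∈v i∈m → ¬meet (i , i∈m , i∈v)
  ... | no ¬miss = contradiction
    (λ m → decidable-stable (meet? _ _) (λ ¬meet → ¬miss (m , ¬meet))) (¬all-meet P v a∉v)

  separate : ∀ {S} → (∀ a → Pencil S a) → ∀ {a} {u v : KVertex n k} →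
    a ∈ proj₁ u → a ∉ proj₁ v → ∃[ x ] (x ∈ₗ S × Dist G v x 1 × ¬ Dist G u x 1)
  separate pencil {a} {u} {v} a∈u a∉v with m , v∩x≡∅ ← pencil-misses (pencil a) v a∉v =
    member m , member∈S m , dist-one v∩x≡∅ (a∈member m) a∉v , not-dist-one a∈u (a∈member m)
    where open Pencil (pencil a)

  pencils⇒resolving : ∀ {S} → (∀ a → Pencil S a) → Resolving G S
  pencils⇒resolving pencil u v u≢v with differ (proj₁ u) (proj₁ v) (u≢v ∘ vertex-≡)
  ... | inj₁ (a , a∈u , a∉v) with x , x∈S , d₁ , ¬d₁ ← separate pencil a∈u a∉v =
    x , x∈S , inj₂ (1 , d₁ , ¬d₁)
  ... | inj₂ (a , a∈v , a∉u) with x , x∈S , d₁ , ¬d₁ ← separate pencil a∈v a∉u =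
    x , x∈S , inj₁ (1 , d₁ , ¬d₁)

module Modular (M : ℕ) .{{_ : NonZero M}} where

  open ≡-Reasoning

  %-absorbˡ : ∀ a c → (a % M + c) % M ≡ (a + c) % M
  %-absorbˡ a c = begin
    (a % M + c) % M         ≡⟨ %-distribˡ-+ (a % M) c M ⟩
    (a % M % M + c % M) % M ≡⟨ cong (λ z → (z + c % M) % M) (m%n%n≡m%n a M) ⟩
    (a % M + c % M) % M     ≡⟨ %-distribˡ-+ a c M ⟨
    (a + c) % M             ∎

  %-cong-+ʳ : ∀ {a b} c → a % M ≡ b % M → (a + c) % M ≡ (b + c) % M
  %-cong-+ʳ {a} {b} c a≡b = begin
    (a + c) % M     ≡⟨ %-absorbˡ a c ⟨
    (a % M + c) % M ≡⟨ cong (λ z → (z + c) % M) a≡b ⟩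
    (b % M + c) % M ≡⟨ %-absorbˡ b c ⟩
    (b + c) % M     ∎

  neg : ℕ → ℕ
  neg c = M ∸ c % M

  M∣c+neg[c] : ∀ c → M ∣ c + neg c
  M∣c+neg[c] c = divides (suc (c / M)) (begin
    c + neg c                         ≡⟨ cong (_+ neg c) (m≡m%n+[m/n]*n c M) ⟩
    c % M + c / M * M + neg c         ≡⟨ cong (_+ neg c) (+-comm (c % M) (c / M * M)) ⟩
    c / M * M + c % M + neg c         ≡⟨ +-assoc (c / M * M) (c % M) (neg c) ⟩
    c / M * M + (c % M + (M ∸ c % M)) ≡⟨ cong (c / M * M +_) (m+[n∸m]≡n (m%n≤n c M)) ⟩
    c / M * M + M                     ≡⟨ +-comm (c / M * M) M ⟩
    suc (c / M) * M                   ∎)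

  %-+-neg : ∀ a c → (a + c + neg c) % M ≡ a % M
  %-+-neg a c = trans (cong (_% M) (+-assoc a c (neg c))) (%-remove-+ʳ a (M∣c+neg[c] c))

  %-cancel-+ˡ : ∀ c {a b} → (c + a) % M ≡ (c + b) % M → a % M ≡ b % M
  %-cancel-+ˡ c {a} {b} c+a≡c+b = begin
    a % M               ≡⟨ %-+-neg a c ⟨
    (a + c + neg c) % M ≡⟨ cong (λ z → (z + neg c) % M) (+-comm a c) ⟩
    (c + a + neg c) % M ≡⟨ %-cong-+ʳ (neg c) c+a≡c+b ⟩
    (c + b + neg c) % M ≡⟨ cong (λ z → (z + neg c) % M) (+-comm c b) ⟩
    (b + c + neg c) % M ≡⟨ %-+-neg b c ⟩
    b % M               ∎

  solve-intercept : ∀ y c → y < M → ((y + neg c) % M + c) % M ≡ y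
  solve-intercept y c y<M = begin
    ((y + neg c) % M + c) % M ≡⟨ %-absorbˡ (y + neg c) c ⟩
    (y + neg c + c) % M       ≡⟨ cong (_% M) (+-assoc y (neg c) c) ⟩
    (y + (neg c + c)) % M     ≡⟨ cong (λ z → (y + z) % M) (+-comm (neg c) c) ⟩
    (y + (c + neg c)) % M     ≡⟨ %-remove-+ʳ y (M∣c+neg[c] c) ⟩
    y % M                     ≡⟨ m<n⇒m%n≡m y<M ⟩
    y                         ∎

  %-injective : ∀ {a b} → a < M → b < M → a % M ≡ b % M → a ≡ b
  %-injective {a} {b} a<M b<M a≡b =
    trans (sym (m<n⇒m%n≡m a<M)) (trans a≡b (m<n⇒m%n≡m b<M))

  slope-unique : ∀ b b' s s' t d → 0 < d → s * d < M → s' * d < M →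
    (b + s * t) % M ≡ (b' + s' * t) % M →
    (b + s * (t + d)) % M ≡ (b' + s' * (t + d)) % M → s ≡ s'
  slope-unique b b' s s' t d d>0 sd<M s'd<M agree-t agree-t+d =
    *-cancelʳ-≡ s s' d {{>-nonZero d>0}}
      (%-injective sd<M s'd<M (%-cancel-+ˡ ((b + s * t) % M) (begin
        ((b + s * t) % M + s * d) % M     ≡⟨ step b s ⟩
        (b + s * (t + d)) % M             ≡⟨ agree-t+d ⟩
        (b' + s' * (t + d)) % M           ≡⟨ step b' s' ⟨
        ((b' + s' * t) % M + s' * d) % M  ≡⟨ cong (λ z → (z + s' * d) % M) agree-t ⟨
        ((b + s * t) % M + s' * d) % M    ∎)))
    where
      step : ∀ c r → ((c + r * t) % M + r * d) % M ≡ (c + r * (t + d)) % M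
      step c r = trans (%-absorbˡ (c + r * t) (r * d)) (cong (_% M) (begin
        c + r * t + r * d   ≡⟨ +-assoc c (r * t) (r * d) ⟩
        c + (r * t + r * d) ≡⟨ cong (c +_) (*-distribˡ-+ r t d) ⟨
        c + r * (t + d)     ∎))

-- The graph {(t , f t)} of f, with (t , y) encoded as combine t y.
graph : ∀ {k M} → (Fin k → Fin M) → Subset (k * M)
graph f = concat (Vec.tabulate (λ t → ⁅ f t ⁆))

∣p++q∣ : ∀ {m n} (p : Subset m) (q : Subset n) → ∣ p ++ q ∣ ≡ ∣ p ∣ + ∣ q ∣
∣p++q∣ []            q = refl
∣p++q∣ (inside ∷ p)  q = cong suc (∣p++q∣ p q)
∣p++q∣ (outside ∷ p) q = ∣p++q∣ p q

∣graph∣ : ∀ {k M} (f : Fin k → Fin M) → ∣ graph f ∣ ≡ k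
∣graph∣ {zero}  f = refl
∣graph∣ {suc k} f = trans (∣p++q∣ ⁅ f Fin.zero ⁆ (graph (f ∘ Fin.suc)))
                          (cong₂ _+_ (∣⁅x⁆∣≡1 (f Fin.zero)) (∣graph∣ (f ∘ Fin.suc)))

lookup-graph : ∀ {k M} (f : Fin k → Fin M) t y →
  lookup (graph f) (combine t y) ≡ lookup ⁅ f t ⁆ y
lookup-graph f t y = trans (lookup-concat (Vec.tabulate (λ t → ⁅ f t ⁆)) t y)
                           (cong (λ s → lookup s y) (lookup∘tabulate (λ t → ⁅ f t ⁆) t))

∈graph⁺ : ∀ {k M} (f : Fin k → Fin M) t → combine t (f t) ∈ graph f
∈graph⁺ f t = lookup⇒[]= _ _ (trans (lookup-graph f t (f t)) ([]=⇒lookup (x∈⁅x⁆ (f t))))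

∈graph⁻ : ∀ {k M} (f : Fin k → Fin M) t y → combine t y ∈ graph f → y ≡ f t
∈graph⁻ f t y y∈ =
  x∈⁅y⁆⇒x≡y (f t) (lookup⇒[]= y _ (trans (sym (lookup-graph f t y)) ([]=⇒lookup y∈)))

module Lines (k M : ℕ) .{{_ : NonZero M}} where

  open Modular M

  lineMap : Fin (suc k) → Fin M → Fin k → Fin M
  lineMap m b t = fromℕ< (m%n<n (toℕ b + toℕ m * toℕ t) M)

  line : Fin (suc k) → Fin M → KVertex (k * M) k
  line m b = graph (lineMap m b) , ∣graph∣ (lineMap m b)

  lines : List (KVertex (k * M) k)
  lines = List.tabulate (λ i → uncurry line (remQuot {suc k} M i))

  length-lines : length lines ≡ suc k * M
  length-lines = length-tabulate _

  line∈lines : ∀ m b → line m b ∈ₗ lines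
  line∈lines m b =
    subst (_∈ₗ lines) (cong (uncurry line) (remQuot-combine m b)) (∈-tabulate⁺ (combine m b))

  intercept : Fin (suc k) → Fin k → Fin M → Fin M
  intercept m t₀ y₀ = fromℕ< (m%n<n (toℕ y₀ + neg (toℕ m * toℕ t₀)) M)

  lineMap-intercept : ∀ m t₀ y₀ → lineMap m (intercept m t₀ y₀) t₀ ≡ y₀
  lineMap-intercept m t₀ y₀ = toℕ-injective (begin
    toℕ (lineMap m (intercept m t₀ y₀) t₀)          ≡⟨ toℕ-fromℕ< _ ⟩
    (toℕ (intercept m t₀ y₀) + c) % M               ≡⟨ cong (λ z → (z + c) % M) (toℕ-fromℕ< _) ⟩
    ((toℕ y₀ + neg c) % M + c) % M                  ≡⟨ solve-intercept (toℕ y₀) c (toℕ<n y₀) ⟩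
    toℕ y₀                                          ∎)
    where
      open ≡-Reasoning
      c : ℕ
      c = toℕ m * toℕ t₀

  module _ (small : k * (k ∸ 1) < M) where

    -- Two lines agreeing in columns t < t' have the same slope: their
    -- slopes times the gap t' - t ≤ k - 1 stay below M.
    slopes-agree : ∀ m m' {b b'} {t t' : Fin k} → toℕ t < toℕ t' →
      lineMap m b t ≡ lineMap m' b' t → lineMap m b t' ≡ lineMap m' b' t' → m ≡ m'
    slopes-agree m m' {b} {b'} {t} {t'} t<t' agree-t agree-t' =
      toℕ-injective (slope-unique (toℕ b) (toℕ b') (toℕ m) (toℕ m') (toℕ t) d
        (m<n⇒0<n∸m t<t') (slope×gap<M m) (slope×gap<M m')
        (residue agree-t) (subst (λ z → (toℕ b + toℕ m * z) % M ≡ (toℕ b' + toℕ m' * z) % M)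
                                 (sym t+d≡t') (residue agree-t')))
      where
        d : ℕ
        d = toℕ t' ∸ toℕ t
        t+d≡t' : toℕ t + d ≡ toℕ t'
        t+d≡t' = m+[n∸m]≡n (<⇒≤ t<t')
        slope×gap<M : (s : Fin (suc k)) → toℕ s * d < M
        slope×gap<M s = ≤-<-trans (*-mono-≤ (s≤s⁻¹ (toℕ<n s))
          (≤-trans (m∸n≤m (toℕ t') (toℕ t)) (pred-mono-≤ (toℕ<n t')))) small
        residue : ∀ {u} → lineMap m b u ≡ lineMap m' b' u →
          (toℕ b + toℕ m * toℕ u) % M ≡ (toℕ b' + toℕ m' * toℕ u) % M
        residue eq = trans (sym (toℕ-fromℕ< _)) (trans (cong toℕ eq) (toℕ-fromℕ< _))

    pencil : (t₀ : Fin k) (y₀ : Fin M) → Pencil lines (combine t₀ y₀)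
    pencil t₀ y₀ = record
      { member     = L
      ; member∈S   = λ m → line∈lines m (intercept m t₀ y₀)
      ; a∈member   = through
      ; concurrent = concurrent
      }
      where
        L : Fin (suc k) → KVertex (k * M) k
        L m = line m (intercept m t₀ y₀)
        through : ∀ m → combine t₀ y₀ ∈ proj₁ (L m)
        through m = subst (λ y → combine t₀ y ∈ proj₁ (L m)) (lineMap-intercept m t₀ y₀)
                          (∈graph⁺ _ t₀)
        at-t₀ : ∀ m m' → lineMap m (intercept m t₀ y₀) t₀ ≡ lineMap m' (intercept m' t₀ y₀) t₀
        at-t₀ m m' = trans (lineMap-intercept m t₀ y₀) (sym (lineMap-intercept m' t₀ y₀))
        at : ∀ m m' {t y} → combine t y ∈ proj₁ (L m) → combine t y ∈ proj₁ (L m') →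
             lineMap m (intercept m t₀ y₀) t ≡ lineMap m' (intercept m' t₀ y₀) t
        at m m' {t} {y} y∈L y∈L' = trans (sym (∈graph⁻ _ t y y∈L)) (∈graph⁻ _ t y y∈L')
        concurrent : ∀ {m m' i} → i ∈ proj₁ (L m) → i ∈ proj₁ (L m') →
                     i ≡ combine t₀ y₀ ⊎ m ≡ m'
        concurrent {m} {m'} {i} i∈L i∈L' with t , y , refl ← combine-surjective {k} {M} i
          with <-cmp (toℕ t₀) (toℕ t)
        ... | tri< t₀<t _ _ = inj₂ (slopes-agree m m' t₀<t (at-t₀ m m') (at m m' i∈L i∈L'))
        ... | tri> _ _ t<t₀ = inj₂ (slopes-agree m m' t<t₀ (at m m' i∈L i∈L') (at-t₀ m m'))
        ... | tri≈ _ t₀≡t _ with refl ← toℕ-injective t₀≡t =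
          inj₁ (cong (combine t₀) (trans (∈graph⁻ _ t₀ y i∈L) (lineMap-intercept m t₀ y₀)))

grid-bound : ∀ k M .{{_ : NonZero M}} → k * (k ∸ 1) < M →
  MetricDimLE (Kneser (k * M) k) (suc k * M)
grid-bound k M small = lines , pencils⇒resolving pencil-at , ≤-reflexive length-lines
  where
    open Lines k M
    pencil-at : ∀ a → Pencil lines a
    pencil-at a = subst (Pencil lines) (combine-remQuot {k} M a)
                        (uncurry (pencil small) (remQuot {k} M a))

weaken : ∀ {G a b} → MetricDimLE G a → a ≤ b → MetricDimLE G b
weaken (S , resolving , ∣S∣≤a) a≤b = S , resolving , ≤-trans ∣S∣≤a a≤b

primePower≥2 : ∀ {q} → IsPrimePower q → 2 ≤ q
primePower≥2 (p , zero  , _       , () , _)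
primePower≥2 (p , suc e , p-prime , _  , refl) = ≤-trans (nonTrivial⇒n>1 p) (m≤m*n p (p ^ e))
  where
    instance
      _ = prime⇒nonTrivial p-prime
      _ = m^n≢0 p e {{prime⇒nonZero p-prime}}

succ-small : ∀ x M → (x + 1) * x < M → (x + 1) * (x + 1 ∸ 1) < M
succ-small x M = subst (λ z → (x + 1) * z < M) (sym (m+n∸n≡m x 1))

≤-by : ∀ {a b} c → a + c ≡ b → a ≤ b
≤-by {a} c refl = m≤m+n a c

-- Polynomial inequalities in q = r + 2, with slacks written in r; note
-- that 1 + 3r + r² = q² - q - 1 and 3 + 8r + 5r² + r³ = q³ - q² - 1.
module Polynomials (r : ℕ) where

  open +-*-Solver

  i-small : (2 + r) * (1 + r) < (2 + r) ^ 2
  i-small = ≤-by (1 + r) (solve 1 (λ r → let q = con 2 :+ r in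
    con 1 :+ q :* (con 1 :+ r) :+ (con 1 :+ r) := q :^ 2) refl r)

  i-size : suc (2 + r) * (2 + r) ^ 2 ≤ (2 + r) ^ 2 * (2 + r + 2)
  i-size = ≤-by ((2 + r) ^ 2) (solve 1 (λ r → let q = con 2 :+ r in
    (con 1 :+ q) :* q :^ 2 :+ q :^ 2 := q :^ 2 :* (q :+ con 2)) refl r)

  ii-small : (2 + r + 1) * (2 + r) < (2 + r) ^ 3 + 1
  ii-small = ≤-by ((2 + r) * (1 + 3 * r + r * r)) (solve 1 (λ r → let q = con 2 :+ r in
    con 1 :+ (q :+ con 1) :* q :+ q :* (con 1 :+ con 3 :* r :+ r :* r) := q :^ 3 :+ con 1) refl r)

  ii-size : suc (2 + r + 1) ≤ (2 + r) ^ 2 + 1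
  ii-size = ≤-by (1 + 3 * r + r * r) (solve 1 (λ r → let q = con 2 :+ r in
    con 1 :+ (q :+ con 1) :+ (con 1 :+ con 3 :* r :+ r :* r) := q :^ 2 :+ con 1) refl r)

  iii-small : ((2 + r) ^ 2 + 1) * (2 + r) ^ 2 < (2 + r) ^ 5 + 1
  iii-small = ≤-by ((2 + r) ^ 2 * (3 + 8 * r + 5 * r ^ 2 + r ^ 3)) (solve 1 (λ r → let q = con 2 :+ r in
    con 1 :+ (q :^ 2 :+ con 1) :* q :^ 2 :+ q :^ 2 :* (con 3 :+ con 8 :* r :+ con 5 :* r :^ 2 :+ r :^ 3)
    := q :^ 5 :+ con 1) refl r)

  iii-size : suc ((2 + r) ^ 2 + 1) ≤ (2 + r) ^ 3 + 1
  iii-size = ≤-by (3 + 8 * r + 5 * r ^ 2 + r ^ 3) (solve 1 (λ r → let q = con 2 :+ r in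
    con 1 :+ (q :^ 2 :+ con 1) :+ (con 3 :+ con 8 :* r :+ con 5 :* r :^ 2 :+ r :^ 3)
    := q :^ 3 :+ con 1) refl r)

corollary4p3 : (q : ℕ) → IsPrimePower q →
    MetricDimLE (Kneser (q ^ 3) q) (q ^ 2 * (q + 2))
    × MetricDimLE (Kneser ((q + 1) * (q ^ 3 + 1)) (q + 1)) ((q ^ 2 + 1) * (q ^ 3 + 1))
    × MetricDimLE (Kneser ((q ^ 2 + 1) * (q ^ 5 + 1)) (q ^ 2 + 1)) ((q ^ 3 + 1) * (q ^ 5 + 1))
corollary4p3 zero          q-pp = contradiction (primePower≥2 q-pp) λ ()
corollary4p3 (suc zero)    q-pp = contradiction (primePower≥2 q-pp) λ { (s≤s ()) }
corollary4p3 q@(suc (suc r)) _  =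
    weaken (grid-bound q (q ^ 2) i-small) i-size
  , weaken (grid-bound (q + 1) (q ^ 3 + 1) (succ-small q _ ii-small))
           (*-monoˡ-≤ (q ^ 3 + 1) ii-size)
  , weaken (grid-bound (q ^ 2 + 1) (q ^ 5 + 1) (succ-small (q ^ 2) _ iii-small))
           (*-monoˡ-≤ (q ^ 5 + 1) iii-size)
  where open Polynomials r
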